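{- For each $n\ge1$, Han's map $H\colon S_n\to S_n$ satisfies $H=I^{ -1}\circ M$; that is, $H$ is a bijection on $S_n$ with $M(\sigma)=I(H(\sigma))$ for every $\sigma\in S_n$.
   Context: $S_n$ is the set of permutations of $[n]$ in one-line notation. Let $E_n=\{(a_1,\ldots,a_n)\in\mathbb Z^n: 0\le a_i\le i-1\}$. Cyclic intervals: for $x,y\in[n]$, $\rrbracket x,y\rrbracket=\{z\in[n]:x<z\le y\}$ if $x\le y$, and $\{z\in[n]: z>x\text{ or }z\le y\}$ if $x>y$; $\rrbracket x,\infty\rrbracket=\{z\in[n]:z>x\}$. For $\sigma\in S_n$ let $t_i(\sigma)=\#\{j<i:\sigma_j\in\rrbracket\sigma_i,\infty\rrbracket\}$ and $s_i(\sigma)=\#\{j<i:\sigma_j\in\rrbracket\sigma_i,\sigma_{i+1}\rrbracket\}$ (with $\sigma_{n+1}=\infty$). The inversion code $I(\sigma)=(t_1(\sigma),\ldots,t_n(\sigma))$ and the cyclic major code $M(\sigma)=(s_1(\sigma),\ldots,s_n(\sigma))$ are both bijections $S_n\to E_n$. For $x\in[n]$ and a permutation $\sigma=\sigma_1\cdots\sigma_{n-1}$ of $[n]\setminus\{x\}$, define $C^x(\sigma)=\tau_1\cdots\tau_{n-1}\in S_{n-1}$ with $\tau_i=\sigma_i-x+n$ if $\sigma_i<x$ and $\tau_i=\sigma_i-x$ if $\sigma_i>x$; and define the standardization $C_x(\sigma)=\nu_1\cdots\nu_{n-1}\in S_{n-1}$ with $\nu_i=\sigma_i$ if $\sigma_i<x$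 and $\nu_i=\sigma_i-1$ if $\sigma_i>x$. Both are bijections from permutations of $[n]\setminus\{x\}$ onto $S_{n-1}$. Han's map $H$ is defined recursively by $H(1)=1$ and, for $\sigma\in S_n$ with $n>1$ and $\sigma'=\sigma_1\cdots\sigma_{n-1}$, $H(\sigma)=C_{\sigma_n}^{ -1}\big(H(C^{\sigma_n}(\sigma'))\big)\cdot\sigma_n$ (concatenation). -}

module Defs where

open import Data.Nat using (ℕ; zero; suc; _+_; _∸_; _<ᵇ_)
open import Data.Bool using (Bool; true; false; if_then_else_; _∧_; _∨_; not)
open import Data.List using (List; []; _∷_; map; reverse; length; upTo)
open import Data.Maybe using (Maybe; just; nothing)
open import Data.List.Relation.Binary.Permutation.Propositional using (_↭_)

_≤ᵇ'_ : ℕ → ℕ → Bool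
x ≤ᵇ' y = x <ᵇ suc y

countB : (ℕ → Bool) → List ℕ → ℕ
countB p [] = 0
countB p (z ∷ zs) = if p z then suc (countB p zs) else countB p zs

-- membership test for the cyclic interval ⟧x,y⟧, with `nothing` playing the role of ∞
inCyc : ℕ → Maybe ℕ → ℕ → Bool
inCyc x nothing z = x <ᵇ z
inCyc x (just y) z =
  if x ≤ᵇ' y then (x <ᵇ z) ∧ (z ≤ᵇ' y) else ((x <ᵇ z) ∨ (z ≤ᵇ' y))

nextOf : List ℕ → Maybe ℕ
nextOf [] = nothing
nextOf (y ∷ _) = just y

-- S n : σ (a list in one-line notation) is a permutation of [n] = {1,…,n}
S : ℕ → List ℕ → Set
S n σ = σ ↭ map suc (upTo n)

-- inversion code; `pre` holds the already-read prefix σ_1 … σ_{i-1}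
Iacc : List ℕ → List ℕ → List ℕ
Iacc pre [] = []
Iacc pre (a ∷ rest) = countB (inCyc a nothing) pre ∷ Iacc (a ∷ pre) rest

I : List ℕ → List ℕ
I σ = Iacc [] σ

-- cyclic major code (σ_{n+1} = ∞ is represented by nextOf [] = nothing)
Macc : List ℕ → List ℕ → List ℕ
Macc pre [] = []
Macc pre (a ∷ rest) = countB (inCyc a (nextOf rest)) pre ∷ Macc (a ∷ pre) rest

M : List ℕ → List ℕ
M σ = Macc [] σ

Cup : ℕ → ℕ → ℕ → ℕ
Cup n x v = if v <ᵇ x then (v + n) ∸ x else v ∸ x

CdownInv : ℕ → ℕ → ℕ
CdownInv x v = if v <ᵇ x then v else suc v

-- Hrev n r = reverse (H (reverse r)) where n = length r:
-- for σ = σ' · x ∈ S_n, reverse σ = x ∷ reverse σ' and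
-- reverse (H σ) = x ∷ map C_x^{-1} (reverse (H (C^x σ'))).
Hrev : ℕ → List ℕ → List ℕ
Hrev zero r = []
Hrev (suc m) [] = []
Hrev (suc m) (x ∷ r) = x ∷ map (CdownInv x) (Hrev m (map (Cup (suc m) x) r))

H : List ℕ → List ℕ
H σ = reverse (Hrev (length σ) (reverse σ))

module Submission where

-- Han's map reads σ from the right: it removes the last letter x, rotates the remaining
-- letters by C^x (which sends x to the top value n), recurses, and re-inserts by the
-- order-preserving C_x⁻¹.  The key fact is that z ∈ ⟧a,b⟧ holds iff an odd number of the
-- comparisons a < z, b < z, b < a hold, while C^x reverses exactly the comparisons between
-- letters on opposite sides of x, an even number of them among any three letters.  Hence C^x
-- carries ⟧a,b⟧ to ⟧C^x a, C^x b⟧ and ⟧a,x⟧ to ⟧C^x a,∞⟧, so the first n-1 entries of M(σ),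
-- where x follows σ', are the cyclic major code of C^x σ'; by induction this is the
-- inversion code of H(C^x σ'), which C_x⁻¹ leaves unchanged.  The last entries of M(σ) and
-- I(H σ) both count the letters above x in the same set.  Every step is invertible, which
-- makes H a bijection.

open import Defs
open import Data.Bool using (true; false; not; _xor_; if_then_else_)
open import Data.Bool.Properties using (xor-identityʳ; xor-comm)
open import Data.Bool.Solver using (module xor-∧-Solver)
open import Data.Maybe using (Maybe; just; nothing)
open import Data.Nat using (ℕ; zero; suc; pred; _+_; _∸_; _<ᵇ_; _≤_; _<_; s≤s; z≤n; >-nonZero)
open import Data.Nat.Properties
open import Data.List using (List; []; _∷_; map; reverse; length; upTo; _++_; _ʳ++_)
open import Data.List.Properties
  using (map-∘; map-id-local; reverse-map; reverse-involutive; unfold-reverse; reverse-injective;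
         length-map; length-upTo)
open import Data.List.Membership.Propositional using (_∈_)
open import Data.List.Membership.Propositional.Properties using (∈-map⁺; ∈-map⁻; ∈-upTo⁺; ∈-upTo⁻)
open import Data.List.Membership.Propositional.Properties.WithK using (unique∧set⇒bag)
open import Data.List.Relation.Binary.BagAndSetEquality using (∼bag⇒↭)
open import Data.List.Relation.Binary.Permutation.Propositional as ↭ using (_↭_)
open import Data.List.Relation.Binary.Permutation.Propositional.Properties
  using (∈-resp-↭; ↭-reverse; ↭-length)
import Data.List.Relation.Binary.Permutation.Setoid.Properties as Setoid↭
open import Data.List.Relation.Unary.All as All using (All; []; _∷_)
open import Data.List.Relation.Unary.AllPairs as AllPairs using ()
open import Data.List.Relation.Unary.Any using (here; there)
open import Data.List.Relation.Unary.Unique.Propositional using (Unique)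
import Data.List.Relation.Unary.Unique.Propositional.Properties as Unique
open import Data.Product using (Σ; _×_; _,_; proj₁; proj₂)
open import Function.Base using (_∘_)
open import Function.Bundles using (mk⇔)
open import Relation.Binary.Definitions using (DecidableEquality; tri<; tri≈; tri>)
open import Relation.Binary.PropositionalEquality
open import Relation.Nullary using (¬_; yes; no)
open import Relation.Nullary.Negation using (contradiction)
open import Relation.Nullary.Reflects using (ofʸ; ofⁿ; det)

_∈[_] : ℕ → ℕ → Set
v ∈[ n ] = 1 ≤ v × v ≤ n

_∈[_]∖_ : ℕ → ℕ → ℕ → Set
v ∈[ n ]∖ x = v ∈[ n ] × v ≢ x

<ᵇ-true : ∀ {m n} → m < n → (m <ᵇ n) ≡ true
<ᵇ-true {m} {n} m<n = det (<ᵇ-reflects-< m n) (ofʸ m<n)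

<ᵇ-false : ∀ {m n} → n ≤ m → (m <ᵇ n) ≡ false
<ᵇ-false {m} {n} n≤m = det (<ᵇ-reflects-< m n) (ofⁿ (≤⇒≯ n≤m))

<ᵇ-strictMono : ∀ {f : ℕ → ℕ} → (∀ {u v} → u < v → f u < f v) → ∀ u v → (f u <ᵇ f v) ≡ (u <ᵇ v)
<ᵇ-strictMono {f} mono u v with <-cmp u v
... | tri< u<v _ _ = trans (<ᵇ-true (mono u<v)) (sym (<ᵇ-true u<v))
... | tri≈ _ refl _ = trans (<ᵇ-false (≤-refl {f u})) (sym (<ᵇ-false (≤-refl {u})))
... | tri> _ _ v<u = trans (<ᵇ-false (<⇒≤ (mono v<u))) (sym (<ᵇ-false (<⇒≤ v<u)))

≤ᵇ'-not-<ᵇ : ∀ m n → (m ≤ᵇ' n) ≡ not (n <ᵇ m)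
≤ᵇ'-not-<ᵇ zero    zero    = refl
≤ᵇ'-not-<ᵇ zero    (suc n) = refl
≤ᵇ'-not-<ᵇ (suc m) zero    = refl
≤ᵇ'-not-<ᵇ (suc m) (suc n) = ≤ᵇ'-not-<ᵇ m n

inCyc-parity : ∀ a b z → inCyc a (just b) z ≡ (a <ᵇ z) xor ((b <ᵇ z) xor (b <ᵇ a))
inCyc-parity a b z rewrite ≤ᵇ'-not-<ᵇ a b | ≤ᵇ'-not-<ᵇ z b
  with a <ᵇ z | <ᵇ-reflects-< a z | b <ᵇ z | <ᵇ-reflects-< b z | b <ᵇ a | <ᵇ-reflects-< b a
... | true  | _       | true  | _       | true  | _       = refl
... | true  | _       | true  | _       | false | _       = refl
... | true  | _       | false | _       | false | _       = refl
... | false | _       | true  | _       | true  | _       = refl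
... | false | _       | false | _       | true  | _       = refl
... | false | _       | false | _       | false | _       = refl
... | true  | ofʸ a<z | false | ofⁿ b≮z | true  | ofʸ b<a =
  contradiction (<-trans b<a a<z) b≮z
... | false | ofⁿ a≮z | true  | ofʸ b<z | false | ofⁿ b≮a =
  contradiction (<-≤-trans b<z (≮⇒≥ a≮z)) b≮a

<ᵇ-+ʳ : ∀ m n o → (m + o <ᵇ n + o) ≡ (m <ᵇ n)
<ᵇ-+ʳ m n zero rewrite +-identityʳ m | +-identityʳ n = refl
<ᵇ-+ʳ m n (suc o) rewrite +-suc m o | +-suc n o = <ᵇ-+ʳ m n o

<ᵇ-∸ʳ : ∀ {m n o} → o ≤ m → o ≤ n → (m ∸ o <ᵇ n ∸ o) ≡ (m <ᵇ n)
<ᵇ-∸ʳ {o = zero} _ _ = refl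
<ᵇ-∸ʳ {suc m} {suc n} {suc o} (s≤s o≤m) (s≤s o≤n) = <ᵇ-∸ʳ o≤m o≤n

data Side (x v : ℕ) : Set where
  below : v < x → Side x v
  above : x < v → Side x v

side : ∀ {x v} → v ≢ x → Side x v
side {x} {v} v≢x with <-cmp v x
... | tri< v<x _ _ = below v<x
... | tri≈ _ v≡x _ = contradiction v≡x v≢x
... | tri> _ _ x<v = above x<v

Cup-below : ∀ n {x v} → v < x → Cup n x v ≡ v + n ∸ x
Cup-below n v<x rewrite <ᵇ-true v<x = refl

Cup-above : ∀ n {x v} → x < v → Cup n x v ≡ v ∸ x
Cup-above n x<v rewrite <ᵇ-false (<⇒≤ x<v) = refl

Cup-<ᵇ : ∀ {n x u v} → x ≤ n → u ∈[ n ]∖ x → v ∈[ n ]∖ x →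
         (Cup n x u <ᵇ Cup n x v) ≡ (u <ᵇ v) xor ((x <ᵇ u) xor (x <ᵇ v))
Cup-<ᵇ {n} {x} {u} {v} x≤n ((_ , u≤n) , u≢x) ((1≤v , v≤n) , v≢x) with side u≢x | side v≢x
... | below u<x | below v<x
  rewrite Cup-below n u<x | Cup-below n v<x | <ᵇ-false (<⇒≤ u<x) | <ᵇ-false (<⇒≤ v<x) =
  trans (<ᵇ-∸ʳ (≤-trans x≤n (m≤n+m n u)) (≤-trans x≤n (m≤n+m n v)))
        (trans (<ᵇ-+ʳ u v n) (sym (xor-identityʳ (u <ᵇ v))))
... | above x<u | above x<v
  rewrite Cup-above n x<u | Cup-above n x<v | <ᵇ-true x<u | <ᵇ-true x<v =
  trans (<ᵇ-∸ʳ (<⇒≤ x<u) (<⇒≤ x<v)) (sym (xor-identityʳ (u <ᵇ v)))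
... | below u<x | above x<v
  rewrite Cup-below n u<x | Cup-above n x<v | <ᵇ-false (<⇒≤ u<x) | <ᵇ-true x<v
        | <ᵇ-true (<-trans u<x x<v) =
  <ᵇ-false (∸-monoˡ-≤ x (≤-trans v≤n (m≤n+m n u)))
... | above x<u | below v<x
  rewrite Cup-above n x<u | Cup-below n v<x | <ᵇ-true x<u | <ᵇ-false (<⇒≤ v<x)
        | <ᵇ-false (<⇒≤ (<-trans v<x x<u)) =
  <ᵇ-true (∸-monoˡ-< (≤-<-trans u≤n (m<n+m n 1≤v)) (<⇒≤ x<u))

inCyc-Cup : ∀ {n x a b z} → x ≤ n → a ∈[ n ]∖ x → b ∈[ n ]∖ x → z ∈[ n ]∖ x →
            inCyc (Cup n x a) (just (Cup n x b)) (Cup n x z) ≡ inCyc a (just b) z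
inCyc-Cup {n} {x} {a} {b} {z} x≤n a∈ b∈ z∈ = begin
  inCyc (Cup n x a) (just (Cup n x b)) (Cup n x z)
    ≡⟨ inCyc-parity (Cup n x a) (Cup n x b) (Cup n x z) ⟩
  (Cup n x a <ᵇ Cup n x z) xor ((Cup n x b <ᵇ Cup n x z) xor (Cup n x b <ᵇ Cup n x a))
    ≡⟨ cong₂ _xor_ (Cup-<ᵇ x≤n a∈ z∈) (cong₂ _xor_ (Cup-<ᵇ x≤n b∈ z∈) (Cup-<ᵇ x≤n b∈ a∈)) ⟩
  ((a <ᵇ z) xor (sa xor sz)) xor (((b <ᵇ z) xor (sb xor sz)) xor ((b <ᵇ a) xor (sb xor sa)))
    ≡⟨ side-flips-cancel (a <ᵇ z) (b <ᵇ z) (b <ᵇ a) sa sb sz ⟩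
  (a <ᵇ z) xor ((b <ᵇ z) xor (b <ᵇ a))
    ≡⟨ inCyc-parity a b z ⟨
  inCyc a (just b) z ∎
  where
  open ≡-Reasoning
  open xor-∧-Solver using (solve; _:+_; _:=_)
  sa = x <ᵇ a
  sb = x <ᵇ b
  sz = x <ᵇ z
  side-flips-cancel : ∀ p q r s t u →
    (p xor (s xor u)) xor ((q xor (t xor u)) xor (r xor (t xor s))) ≡ p xor (q xor r)
  side-flips-cancel = solve 6 (λ p q r s t u →
    (p :+ (s :+ u)) :+ ((q :+ (t :+ u)) :+ (r :+ (t :+ s))) := p :+ (q :+ r)) refl

inCyc-Cup-∞ : ∀ {n x a z} → x ≤ n → a ∈[ n ]∖ x → z ∈[ n ]∖ x →
              inCyc (Cup n x a) nothing (Cup n x z) ≡ inCyc a (just x) z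
inCyc-Cup-∞ {n} {x} {a} {z} x≤n a∈ z∈ = begin
  Cup n x a <ᵇ Cup n x z                       ≡⟨ Cup-<ᵇ x≤n a∈ z∈ ⟩
  (a <ᵇ z) xor ((x <ᵇ a) xor (x <ᵇ z))         ≡⟨ cong ((a <ᵇ z) xor_) (xor-comm (x <ᵇ a) (x <ᵇ z)) ⟩
  (a <ᵇ z) xor ((x <ᵇ z) xor (x <ᵇ a))         ≡⟨ inCyc-parity a x z ⟨
  inCyc a (just x) z                           ∎
  where open ≡-Reasoning

record Correspondence {A B : Set} (D : A → Set) (E : B → Set) : Set where
  field
    to      : A → B
    from    : B → A
    to-∈    : ∀ {v} → D v → E (to v)
    from-∈  : ∀ {e} → E e → D (from e)
    from-to : ∀ {v} → D v → from (to v) ≡ v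
    to-from : ∀ {e} → E e → to (from e) ≡ e

Correspondence-sym : ∀ {A B : Set} {D : A → Set} {E : B → Set} →
                     Correspondence D E → Correspondence E D
Correspondence-sym c = record
  { to = from ; from = to ; to-∈ = from-∈ ; from-∈ = to-∈ ; from-to = to-from ; to-from = from-to }
  where open Correspondence c

Cup⁻¹ : ℕ → ℕ → ℕ → ℕ
Cup⁻¹ n x e = if n <ᵇ e + x then e + x ∸ n else e + x

module _ {k x : ℕ} (x∈ : x ∈[ suc k ]) where

  private
    1≤x = proj₁ x∈
    x≤n = proj₂ x∈

    wrapped<x : ∀ {e} → e ≤ k → e + x ∸ suc k < x
    wrapped<x {e} e≤k = m<n+o⇒m∸n<o (e + x) (suc k) {{>-nonZero 1≤x}} (+-monoˡ-< x (s≤s e≤k))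

  Cup-∈ : ∀ {v} → v ∈[ suc k ]∖ x → Cup (suc k) x v ∈[ k ]
  Cup-∈ {v} ((1≤v , v≤n) , v≢x) with side v≢x
  ... | below v<x rewrite Cup-below (suc k) v<x =
    m<n⇒0<n∸m (≤-<-trans x≤n (m<n+m (suc k) 1≤v)) ,
    m≤n+o⇒m∸n≤o (v + suc k) x (subst (_≤ x + k) (sym (+-suc v k)) (+-monoˡ-≤ k v<x))
  ... | above x<v rewrite Cup-above (suc k) x<v =
    m<n⇒0<n∸m x<v , m≤n+o⇒m∸n≤o v x (≤-trans v≤n (+-monoˡ-≤ k 1≤x))

  Cup⁻¹-∈ : ∀ {e} → e ∈[ k ] → Cup⁻¹ (suc k) x e ∈[ suc k ]∖ x
  Cup⁻¹-∈ {e} (1≤e , e≤k) with suc k <? e + x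
  ... | yes n<e+x rewrite <ᵇ-true n<e+x =
    (m<n⇒0<n∸m n<e+x , ≤-trans (<⇒≤ (wrapped<x e≤k)) x≤n) , <⇒≢ (wrapped<x e≤k)
  ... | no n≮e+x rewrite <ᵇ-false (≮⇒≥ n≮e+x) =
    (≤-trans 1≤e (m≤m+n e x) , ≮⇒≥ n≮e+x) , >⇒≢ (m<n+m x 1≤e)

  Cup⁻¹-Cup : ∀ {v} → v ∈[ suc k ]∖ x → Cup⁻¹ (suc k) x (Cup (suc k) x v) ≡ v
  Cup⁻¹-Cup {v} ((1≤v , v≤n) , v≢x) with side v≢x
  ... | below v<x rewrite Cup-below (suc k) v<x | m∸n+n≡m (≤-trans x≤n (m≤n+m (suc k) v))
                        | <ᵇ-true (m<n+m (suc k) 1≤v) = m+n∸n≡m v (suc k)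
  ... | above x<v rewrite Cup-above (suc k) x<v | m∸n+n≡m (<⇒≤ x<v) | <ᵇ-false v≤n = refl

  Cup-Cup⁻¹ : ∀ {e} → e ∈[ k ] → Cup (suc k) x (Cup⁻¹ (suc k) x e) ≡ e
  Cup-Cup⁻¹ {e} (1≤e , e≤k) with suc k <? e + x
  ... | yes n<e+x rewrite <ᵇ-true n<e+x | Cup-below (suc k) (wrapped<x e≤k) | m∸n+n≡m (<⇒≤ n<e+x) =
    m+n∸n≡m e x
  ... | no n≮e+x rewrite <ᵇ-false (≮⇒≥ n≮e+x) | Cup-above (suc k) (m<n+m x 1≤e) = m+n∸n≡m e x

  rotation : Correspondence (_∈[ suc k ]∖ x) (_∈[ k ])
  rotation = record
    { to = Cup (suc k) x ; from = Cup⁻¹ (suc k) x ; to-∈ = Cup-∈ ; from-∈ = Cup⁻¹-∈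
    ; from-to = Cup⁻¹-Cup ; to-from = Cup-Cup⁻¹ }

Cdown : ℕ → ℕ → ℕ
Cdown x v = if v <ᵇ x then v else pred v

CdownInv-strictMono : ∀ x {u v} → u < v → CdownInv x u < CdownInv x v
CdownInv-strictMono x {u} {v} u<v with u <? x | v <? x
... | yes u<x | yes v<x rewrite <ᵇ-true u<x | <ᵇ-true v<x = u<v
... | yes u<x | no  v≮x rewrite <ᵇ-true u<x | <ᵇ-false (≮⇒≥ v≮x) = m<n⇒m<1+n u<v
... | no  u≮x | no  v≮x rewrite <ᵇ-false (≮⇒≥ u≮x) | <ᵇ-false (≮⇒≥ v≮x) = s≤s u<v
... | no  u≮x | yes v<x = contradiction (<-trans u<v v<x) u≮x

module _ {k x : ℕ} (x∈ : x ∈[ suc k ]) where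

  Cdown-∈ : ∀ {v} → v ∈[ suc k ]∖ x → Cdown x v ∈[ k ]
  Cdown-∈ {v} ((1≤v , v≤n) , v≢x) with side v≢x
  ... | below v<x rewrite <ᵇ-true v<x = 1≤v , ≤-pred (<-≤-trans v<x (proj₂ x∈))
  ... | above x<v rewrite <ᵇ-false (<⇒≤ x<v) =
    ≤-trans (proj₁ x∈) (pred-mono-≤ x<v) , pred-mono-≤ v≤n

  CdownInv-∈ : ∀ {e} → e ∈[ k ] → CdownInv x e ∈[ suc k ]∖ x
  CdownInv-∈ {e} (1≤e , e≤k) with e <? x
  ... | yes e<x rewrite <ᵇ-true e<x = (1≤e , m≤n⇒m≤1+n e≤k) , <⇒≢ e<x
  ... | no  e≮x rewrite <ᵇ-false (≮⇒≥ e≮x) = (s≤s z≤n , s≤s e≤k) , >⇒≢ (s≤s (≮⇒≥ e≮x))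

  CdownInv-Cdown : ∀ {v} → v ∈[ suc k ]∖ x → CdownInv x (Cdown x v) ≡ v
  CdownInv-Cdown (_ , v≢x) with side v≢x
  CdownInv-Cdown {v}     _ | below v<x rewrite <ᵇ-true v<x | <ᵇ-true v<x = refl
  CdownInv-Cdown {suc w} _ | above x<v rewrite <ᵇ-false (<⇒≤ x<v) | <ᵇ-false (≤-pred x<v) = refl

  Cdown-CdownInv : ∀ {e} → e ∈[ k ] → Cdown x (CdownInv x e) ≡ e
  Cdown-CdownInv {e} _ with e <? x
  ... | yes e<x rewrite <ᵇ-true e<x | <ᵇ-true e<x = refl
  ... | no  e≮x rewrite <ᵇ-false (≮⇒≥ e≮x) | <ᵇ-false (m≤n⇒m≤1+n (≮⇒≥ e≮x)) = refl

  standardization : Correspondence (_∈[ suc k ]∖ x) (_∈[ k ])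
  standardization = record
    { to = Cdown x ; from = CdownInv x ; to-∈ = Cdown-∈ ; from-∈ = CdownInv-∈
    ; from-to = CdownInv-Cdown ; to-from = Cdown-CdownInv }

countB-map : ∀ p f l → countB p (map f l) ≡ countB (λ z → p (f z)) l
countB-map p f [] = refl
countB-map p f (z ∷ l) rewrite countB-map p f l = refl

countB-cong : ∀ {p q} {l} → All (λ z → p z ≡ q z) l → countB p l ≡ countB q l
countB-cong [] = refl
countB-cong {l = z ∷ _} (pz≡qz ∷ eqs) rewrite pz≡qz | countB-cong eqs = refl

countB-↭ : ∀ p {l l′} → l ↭ l′ → countB p l ≡ countB p l′
countB-↭ p ↭.refl = refl
countB-↭ p (↭.prep x l↭l′) rewrite countB-↭ p l↭l′ = refl
countB-↭ p (↭.swap x y l↭l′) rewrite countB-↭ p l↭l′ with p x | p y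
... | true  | true  = refl
... | true  | false = refl
... | false | true  = refl
... | false | false = refl
countB-↭ p (↭.trans l↭l′ l′↭l″) = trans (countB-↭ p l↭l′) (countB-↭ p l′↭l″)

-- Macc with `end` as the letter following the word; Macc itself is the case end = nothing (∞).
MaccEnd : List ℕ → List ℕ → Maybe ℕ → List ℕ
MaccEnd pre [] end = []
MaccEnd pre (a ∷ []) end = countB (inCyc a end) pre ∷ []
MaccEnd pre (a ∷ b ∷ rest) end = countB (inCyc a (just b)) pre ∷ MaccEnd (a ∷ pre) (b ∷ rest) end

Macc≡MaccEnd-∞ : ∀ pre l → Macc pre l ≡ MaccEnd pre l nothing
Macc≡MaccEnd-∞ pre [] = refl
Macc≡MaccEnd-∞ pre (a ∷ []) = refl
Macc≡MaccEnd-∞ pre (a ∷ b ∷ rest) = cong (_ ∷_) (Macc≡MaccEnd-∞ (a ∷ pre) (b ∷ rest))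

MaccEnd-∷ʳ : ∀ pre ρ a end →
  MaccEnd pre (ρ ++ a ∷ []) end ≡ MaccEnd pre ρ (just a) ++ countB (inCyc a end) (ρ ʳ++ pre) ∷ []
MaccEnd-∷ʳ pre [] a end = refl
MaccEnd-∷ʳ pre (c ∷ []) a end = refl
MaccEnd-∷ʳ pre (c ∷ d ∷ ρ) a end = cong (_ ∷_) (MaccEnd-∷ʳ (c ∷ pre) (d ∷ ρ) a end)

Iacc-∷ʳ : ∀ pre ρ a → Iacc pre (ρ ++ a ∷ []) ≡ Iacc pre ρ ++ countB (inCyc a nothing) (ρ ʳ++ pre) ∷ []
Iacc-∷ʳ pre [] a = refl
Iacc-∷ʳ pre (c ∷ ρ) a = cong (_ ∷_) (Iacc-∷ʳ (c ∷ pre) ρ a)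

Iacc-map-strictMono : ∀ {f} → (∀ {u v} → u < v → f u < f v) →
                      ∀ pre ρ → Iacc (map f pre) (map f ρ) ≡ Iacc pre ρ
Iacc-map-strictMono mono pre [] = refl
Iacc-map-strictMono {f} mono pre (a ∷ ρ) = cong₂ _∷_
  (trans (countB-map _ f pre) (countB-cong (All.universal (<ᵇ-strictMono mono a) pre)))
  (Iacc-map-strictMono mono (a ∷ pre) ρ)

MaccEnd-Cup : ∀ {n x} → x ≤ n → ∀ {pre ρ} → All (_∈[ n ]∖ x) pre → All (_∈[ n ]∖ x) ρ →
              MaccEnd (map (Cup n x) pre) (map (Cup n x) ρ) nothing ≡ MaccEnd pre ρ (just x)
MaccEnd-Cup x≤n _ [] = refl
MaccEnd-Cup {n} {x} x≤n {pre} pre∈ (a∈ ∷ []) = cong (_∷ [])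
  (trans (countB-map _ (Cup n x) pre) (countB-cong (All.map (inCyc-Cup-∞ x≤n a∈) pre∈)))
MaccEnd-Cup {n} {x} x≤n {pre} pre∈ (a∈ ∷ b∈ ∷ ρ∈) = cong₂ _∷_
  (trans (countB-map _ (Cup n x) pre) (countB-cong (All.map (inCyc-Cup x≤n a∈ b∈) pre∈)))
  (MaccEnd-Cup x≤n (a∈ ∷ pre∈) (b∈ ∷ ρ∈))

record Enumerates {A : Set} (P : A → Set) (l : List A) : Set where
  field
    unique   : Unique l
    sound    : ∀ {v} → v ∈ l → P v
    complete : ∀ {v} → P v → v ∈ l
open Enumerates

module _ {A : Set} {P : A → Set} where

  Enumerates⇒All : ∀ {l} → Enumerates P l → All P l
  Enumerates⇒All e = All.tabulate (sound e)

  Enumerates-↭ : ∀ {l l′} → Enumerates P l → Enumerates P l′ → l ↭ l′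
  Enumerates-↭ e e′ = ∼bag⇒↭ (unique∧set⇒bag (unique e) (unique e′)
    (mk⇔ (λ v∈l → complete e′ (sound e v∈l)) (λ v∈l′ → complete e (sound e′ v∈l′))))

  Enumerates-resp-↭ : ∀ {l l′} → l ↭ l′ → Enumerates P l → Enumerates P l′
  Enumerates-resp-↭ l↭l′ e = record
    { unique   = Setoid↭.Unique-resp-↭ (setoid A) (↭.↭⇒↭ₛ l↭l′) (unique e)
    ; sound    = λ v∈l′ → sound e (∈-resp-↭ (↭.↭-sym l↭l′) v∈l′)
    ; complete = λ Pv → ∈-resp-↭ l↭l′ (complete e Pv) }

  Enumerates-∷⁻ : ∀ {x r} → Enumerates P (x ∷ r) → P x × Enumerates (λ v → P v × v ≢ x) r
  Enumerates-∷⁻ {x} {r} e with unique e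
  ... | x∉r AllPairs.∷ r! = sound e (here refl) , record
    { unique   = r!
    ; sound    = λ v∈r → sound e (there v∈r) , λ v≡x → All.lookup x∉r v∈r (sym v≡x)
    ; complete = complete-r }
    where
    complete-r : ∀ {v} → P v × v ≢ x → v ∈ r
    complete-r (Pv , v≢x) with complete e Pv
    ... | here v≡x  = contradiction v≡x v≢x
    ... | there v∈r = v∈r

  Enumerates-∷⁺ : DecidableEquality A → ∀ {x r} → P x → Enumerates (λ v → P v × v ≢ x) r →
                  Enumerates P (x ∷ r)
  Enumerates-∷⁺ _≟_ {x} {r} Px e = record
    { unique   = All.tabulate (λ v∈r x≡v → proj₂ (sound e v∈r) (sym x≡v)) AllPairs.∷ unique e
    ; sound    = λ { (here refl) → Px ; (there v∈r) → proj₁ (sound e v∈r) }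
    ; complete = complete-x∷r }
    where
    complete-x∷r : ∀ {v} → P v → v ∈ x ∷ r
    complete-x∷r {v} Pv with v ≟ x
    ... | yes v≡x = here v≡x
    ... | no  v≢x = there (complete e (Pv , v≢x))

module _ {A B : Set} {D : A → Set} {E : B → Set} (c : Correspondence D E) where
  open Correspondence c

  map-from-to : ∀ {l} → All D l → map from (map to l) ≡ l
  map-from-to {l} Dl = trans (sym (map-∘ l)) (map-id-local (All.map from-to Dl))

  Enumerates-map : ∀ {l} → Enumerates D l → Enumerates E (map to l)
  Enumerates-map {l} e = record
    { unique   = Unique.map⁻ (subst Unique (sym (map-from-to (Enumerates⇒All e))) (unique e))
    ; sound    = sound-image
    ; complete = λ Ee → subst (_∈ map to l) (to-from Ee) (∈-map⁺ to (complete e (from-∈ Ee))) }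
    where
    sound-image : ∀ {w} → w ∈ map to l → E w
    sound-image w∈ with ∈-map⁻ to w∈
    ... | v , v∈l , refl = to-∈ (sound e v∈l)

[1‥_] : ℕ → List ℕ
[1‥ n ] = map suc (upTo n)

Enumerates-[1‥] : ∀ n → Enumerates (_∈[ n ]) [1‥ n ]
Enumerates-[1‥] n = record
  { unique   = Unique.map⁺ suc-injective (Unique.upTo⁺ n)
  ; sound    = sound-[1‥]
  ; complete = λ { {suc i} (_ , 1+i≤n) → ∈-map⁺ suc (∈-upTo⁺ 1+i≤n) } }
  where
  sound-[1‥] : ∀ {v} → v ∈ [1‥ n ] → v ∈[ n ]
  sound-[1‥] v∈ with ∈-map⁻ suc v∈
  ... | i , i∈ , refl = s≤s z≤n , ∈-upTo⁻ i∈

S⇒Enumerates : ∀ {n σ} → S n σ → Enumerates (_∈[ n ]) σ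
S⇒Enumerates {n} σ↭ = Enumerates-resp-↭ (↭.↭-sym σ↭) (Enumerates-[1‥] n)

Enumerates⇒S : ∀ {n σ} → Enumerates (_∈[ n ]) σ → S n σ
Enumerates⇒S {n} e = Enumerates-↭ e (Enumerates-[1‥] n)

Enumerates-[0] : ∀ {r} → Enumerates (_∈[ 0 ]) r → r ≡ []
Enumerates-[0] {[]} e = refl
Enumerates-[0] {v ∷ r} e with sound e (here refl)
... | 1≤v , v≤0 = contradiction (≤-trans 1≤v v≤0) λ ()

¬Enumerates-[1+n]-[] : ∀ {k} → ¬ Enumerates (_∈[ suc k ]) []
¬Enumerates-[1+n]-[] e with complete e (s≤s z≤n , s≤s z≤n)
... | ()

Hrev⁻¹ : ℕ → List ℕ → List ℕ
Hrev⁻¹ zero t = []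
Hrev⁻¹ (suc m) [] = []
Hrev⁻¹ (suc m) (x ∷ t) = x ∷ map (Cup⁻¹ (suc m) x) (Hrev⁻¹ m (map (Cdown x) t))

Hrev-enumerates : ∀ m {r} → Enumerates (_∈[ m ]) r → Enumerates (_∈[ m ]) (Hrev m r)
Hrev-enumerates zero e = subst (Enumerates _) (Enumerates-[0] e) e
Hrev-enumerates (suc k) {[]} e = contradiction e ¬Enumerates-[1+n]-[]
Hrev-enumerates (suc k) {x ∷ r} e with Enumerates-∷⁻ e
... | x∈ , eʳ = Enumerates-∷⁺ _≟_ x∈ (Enumerates-map (Correspondence-sym (standardization x∈))
                  (Hrev-enumerates k (Enumerates-map (rotation x∈) eʳ)))

Hrev⁻¹-enumerates : ∀ m {t} → Enumerates (_∈[ m ]) t → Enumerates (_∈[ m ]) (Hrev⁻¹ m t)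
Hrev⁻¹-enumerates zero e = subst (Enumerates _) (Enumerates-[0] e) e
Hrev⁻¹-enumerates (suc k) {[]} e = contradiction e ¬Enumerates-[1+n]-[]
Hrev⁻¹-enumerates (suc k) {x ∷ t} e with Enumerates-∷⁻ e
... | x∈ , eᵗ = Enumerates-∷⁺ _≟_ x∈ (Enumerates-map (Correspondence-sym (rotation x∈))
                  (Hrev⁻¹-enumerates k (Enumerates-map (standardization x∈) eᵗ)))

Hrev⁻¹-Hrev : ∀ m {r} → Enumerates (_∈[ m ]) r → Hrev⁻¹ m (Hrev m r) ≡ r
Hrev⁻¹-Hrev zero e = sym (Enumerates-[0] e)
Hrev⁻¹-Hrev (suc k) {[]} e = contradiction e ¬Enumerates-[1+n]-[]
Hrev⁻¹-Hrev (suc k) {x ∷ r} e with Enumerates-∷⁻ e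
... | x∈ , eʳ = cong (x ∷_) (begin
  map (Cup⁻¹ (suc k) x) (Hrev⁻¹ k (map (Cdown x) (map (CdownInv x) h)))
    ≡⟨ cong (map (Cup⁻¹ (suc k) x) ∘ Hrev⁻¹ k)
            (map-from-to (Correspondence-sym (standardization x∈)) (Enumerates⇒All eʰ)) ⟩
  map (Cup⁻¹ (suc k) x) (Hrev⁻¹ k h)
    ≡⟨ cong (map (Cup⁻¹ (suc k) x)) (Hrev⁻¹-Hrev k eʳ′) ⟩
  map (Cup⁻¹ (suc k) x) (map (Cup (suc k) x) r)
    ≡⟨ map-from-to (rotation x∈) (Enumerates⇒All eʳ) ⟩
  r ∎)
  where
  open ≡-Reasoning
  eʳ′ = Enumerates-map (rotation x∈) eʳ
  h = Hrev k (map (Cup (suc k) x) r)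
  eʰ = Hrev-enumerates k eʳ′

Hrev-Hrev⁻¹ : ∀ m {t} → Enumerates (_∈[ m ]) t → Hrev m (Hrev⁻¹ m t) ≡ t
Hrev-Hrev⁻¹ zero e = sym (Enumerates-[0] e)
Hrev-Hrev⁻¹ (suc k) {[]} e = contradiction e ¬Enumerates-[1+n]-[]
Hrev-Hrev⁻¹ (suc k) {x ∷ t} e with Enumerates-∷⁻ e
... | x∈ , eᵗ = cong (x ∷_) (begin
  map (CdownInv x) (Hrev k (map (Cup (suc k) x) (map (Cup⁻¹ (suc k) x) h)))
    ≡⟨ cong (map (CdownInv x) ∘ Hrev k)
            (map-from-to (Correspondence-sym (rotation x∈)) (Enumerates⇒All eʰ)) ⟩
  map (CdownInv x) (Hrev k h)
    ≡⟨ cong (map (CdownInv x)) (Hrev-Hrev⁻¹ k eᵗ′) ⟩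
  map (CdownInv x) (map (Cdown x) t)
    ≡⟨ map-from-to (standardization x∈) (Enumerates⇒All eᵗ) ⟩
  t ∎)
  where
  open ≡-Reasoning
  eᵗ′ = Enumerates-map (standardization x∈) eᵗ
  h = Hrev⁻¹ k (map (Cdown x) t)
  eʰ = Hrev⁻¹-enumerates k eᵗ′

M-reverse≡I-reverse-Hrev : ∀ m {r} → Enumerates (_∈[ m ]) r → M (reverse r) ≡ I (reverse (Hrev m r))
M-reverse≡I-reverse-Hrev zero e rewrite Enumerates-[0] e = refl
M-reverse≡I-reverse-Hrev (suc k) {[]} e = contradiction e ¬Enumerates-[1+n]-[]
M-reverse≡I-reverse-Hrev (suc k) {x ∷ r} e with Enumerates-∷⁻ e
... | x∈ , eʳ = begin
  M (reverse (x ∷ r))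
    ≡⟨ cong M (unfold-reverse x r) ⟩
  M (reverse r ++ x ∷ [])
    ≡⟨ Macc≡MaccEnd-∞ [] (reverse r ++ x ∷ []) ⟩
  MaccEnd [] (reverse r ++ x ∷ []) nothing
    ≡⟨ MaccEnd-∷ʳ [] (reverse r) x nothing ⟩
  MaccEnd [] (reverse r) (just x) ++ countB (inCyc x nothing) (reverse (reverse r)) ∷ []
    ≡⟨ cong₂ (λ c d → c ++ d ∷ []) earlier-entries last-entry ⟩
  Iacc [] (reverse ℓ) ++ countB (inCyc x nothing) (reverse (reverse ℓ)) ∷ []
    ≡⟨ Iacc-∷ʳ [] (reverse ℓ) x ⟨
  I (reverse ℓ ++ x ∷ [])
    ≡⟨ cong I (unfold-reverse x ℓ) ⟨
  I (reverse (x ∷ ℓ)) ∎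
  where
  open ≡-Reasoning
  rot = map (Cup (suc k) x) r
  h = Hrev k rot
  ℓ = map (CdownInv x) h
  eʳ′ = Enumerates-map (rotation x∈) eʳ
  eˡ = Enumerates-map (Correspondence-sym (standardization x∈)) (Hrev-enumerates k eʳ′)

  earlier-entries : MaccEnd [] (reverse r) (just x) ≡ Iacc [] (reverse ℓ)
  earlier-entries = begin
    MaccEnd [] (reverse r) (just x)
      ≡⟨ MaccEnd-Cup (proj₂ x∈) [] (All.tabulate (sound eʳ ∘ ∈-resp-↭ (↭-reverse r))) ⟨
    MaccEnd [] (map (Cup (suc k) x) (reverse r)) nothing
      ≡⟨ cong (λ l → MaccEnd [] l nothing) (reverse-map (Cup (suc k) x) r) ⟩
    MaccEnd [] (reverse rot) nothing
      ≡⟨ Macc≡MaccEnd-∞ [] (reverse rot) ⟨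
    M (reverse rot)
      ≡⟨ M-reverse≡I-reverse-Hrev k eʳ′ ⟩
    I (reverse h)
      ≡⟨ Iacc-map-strictMono (CdownInv-strictMono x) [] (reverse h) ⟨
    Iacc [] (map (CdownInv x) (reverse h))
      ≡⟨ cong (Iacc []) (reverse-map (CdownInv x) h) ⟩
    Iacc [] (reverse ℓ) ∎

  last-entry : countB (inCyc x nothing) (reverse (reverse r)) ≡ countB (inCyc x nothing) (reverse (reverse ℓ))
  last-entry = begin
    countB (inCyc x nothing) (reverse (reverse r)) ≡⟨ cong (countB _) (reverse-involutive r) ⟩
    countB (inCyc x nothing) r                     ≡⟨ countB-↭ _ (Enumerates-↭ eʳ eˡ) ⟩
    countB (inCyc x nothing) ℓ                     ≡⟨ cong (countB _) (reverse-involutive ℓ) ⟨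
    countB (inCyc x nothing) (reverse (reverse ℓ)) ∎

S-length : ∀ {n σ} → S n σ → length σ ≡ n
S-length {n} σ↭ = trans (↭-length σ↭) (trans (length-map suc (upTo n)) (length-upTo n))

S-reverse : ∀ {n σ} → S n σ → S n (reverse σ)
S-reverse {σ = σ} σ↭ = ↭.↭-trans (↭-reverse σ) σ↭

H-via-Hrev : ∀ {n σ} → S n σ → H σ ≡ reverse (Hrev n (reverse σ))
H-via-Hrev {σ = σ} σ↭ = cong (λ m → reverse (Hrev m (reverse σ))) (S-length σ↭)

H-preserves-S : ∀ {n} σ → S n σ → S n (H σ)
H-preserves-S {n} σ σ↭ = subst (S n) (sym (H-via-Hrev σ↭))
  (S-reverse (Enumerates⇒S (Hrev-enumerates n (S⇒Enumerates (S-reverse σ↭)))))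

H-injective : ∀ {n} σ τ → S n σ → S n τ → H σ ≡ H τ → σ ≡ τ
H-injective {n} σ τ σ↭ τ↭ Hσ≡Hτ = reverse-injective (begin
  reverse σ                           ≡⟨ Hrev⁻¹-Hrev n (S⇒Enumerates (S-reverse σ↭)) ⟨
  Hrev⁻¹ n (Hrev n (reverse σ))      ≡⟨ cong (Hrev⁻¹ n) (reverse-injective Hrevσ≡Hrevτ) ⟩
  Hrev⁻¹ n (Hrev n (reverse τ))      ≡⟨ Hrev⁻¹-Hrev n (S⇒Enumerates (S-reverse τ↭)) ⟩
  reverse τ                           ∎)
  where
  open ≡-Reasoning
  Hrevσ≡Hrevτ = trans (sym (H-via-Hrev σ↭)) (trans Hσ≡Hτ (H-via-Hrev τ↭))

H-surjective : ∀ {n} τ → S n τ → Σ (List ℕ) (λ σ → S n σ × H σ ≡ τ)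
H-surjective {n} τ τ↭ = σ , σ↭ , (begin
  H σ                                    ≡⟨ H-via-Hrev σ↭ ⟩
  reverse (Hrev n (reverse σ))           ≡⟨ cong (reverse ∘ Hrev n) (reverse-involutive _) ⟩
  reverse (Hrev n (Hrev⁻¹ n (reverse τ))) ≡⟨ cong reverse (Hrev-Hrev⁻¹ n eᵗ) ⟩
  reverse (reverse τ)                    ≡⟨ reverse-involutive τ ⟩
  τ                                      ∎)
  where
  open ≡-Reasoning
  eᵗ = S⇒Enumerates (S-reverse τ↭)
  σ = reverse (Hrev⁻¹ n (reverse τ))
  σ↭ = S-reverse (Enumerates⇒S (Hrev⁻¹-enumerates n eᵗ))

M≡I∘H : ∀ {n} σ → S n σ → M σ ≡ I (H σ)
M≡I∘H {n} σ σ↭ = begin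
  M σ                                ≡⟨ cong M (reverse-involutive σ) ⟨
  M (reverse (reverse σ))            ≡⟨ M-reverse≡I-reverse-Hrev n (S⇒Enumerates (S-reverse σ↭)) ⟩
  I (reverse (Hrev n (reverse σ)))   ≡⟨ cong I (H-via-Hrev σ↭) ⟨
  I (H σ)                            ∎
  where open ≡-Reasoning

theorem2p2 : (n : ℕ) → 1 ≤ n →
    ((σ : List ℕ) → S n σ → S n (H σ))
    × ((σ τ : List ℕ) → S n σ → S n τ → H σ ≡ H τ → σ ≡ τ)
    × ((τ : List ℕ) → S n τ → Σ (List ℕ) (λ σ → S n σ × H σ ≡ τ))
    × ((σ : List ℕ) → S n σ → M σ ≡ I (H σ))
theorem2p2 n _ = H-preserves-S , H-injective , H-surjective , M≡I∘H
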